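{- Let $I_n$ be the number of inversion sequences $(a_1,\dots,a_n)$ for which there are no indices $i<j<k$ with $a_i>a_k$ (equivalently, avoiding the patterns $100,110,120,201,210$), with $I_0=1$. Let $X\equiv X(z)=1+2z+5z^2+17z^3+64z^4+\cdots$ be the unique formal power series root (in $z$) of \[ 1-x+z-zx+2zx^2-z^2x^3=0 . \] Then \[ \sum_{n\ge0} I_n z^n=\frac{(1+z)(X-1)-z(1-z)X^2}{z(1+z)X}. \]
   Context: An inversion sequence of length $n$ is an integer sequence $(a_1,\dots,a_n)$ with $0\le a_i<i$ for all $i$. A pattern is a sequence of non-negative integers containing every value from $0$ to its maximum; a sequence contains a pattern $\sigma$ of length $k$ if some subsequence $a_{i_1}\cdots a_{i_k}$ ($i_1<\dots<i_k$) has the same relative order (including equalities) as $\sigma$, and avoids it otherwise. The empty sequence is the unique inversion sequence of length $0$. -}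

module Defs where

open import Data.Nat as ℕ using (ℕ; zero; suc; _<_; _<?_; _≤_)
open import Data.Integer as ℤ using (ℤ; +_)
open import Data.Fin using (Fin; toℕ)
open import Data.Fin.Properties using (all?)
open import Data.Vec using (Vec; []; _∷_; lookup)
open import Data.List using (List; [_]; map; concatMap; upTo; length; filter; foldr)
open import Data.Product using (_×_)
open import Relation.Nullary using (¬_; Dec)
open import Relation.Nullary.Decidable using (_×-dec_; ¬?; _→-dec_)

-- Inversion sequences (0-indexed positions: a_i < i+1, i.e. 0 ≤ a_i < i
-- in the paper's 1-indexed convention)

IsInversionSequence : ∀ {n} → Vec ℕ n → Set
IsInversionSequence {n} a = ∀ (i : Fin n) → lookup a i < suc (toℕ i)

Avoids : ∀ {n} → Vec ℕ n → Set
Avoids {n} a = ∀ (i j k : Fin n) → toℕ i < toℕ j → toℕ j < toℕ k →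
               ¬ (lookup a k < lookup a i)

isInv? : ∀ {n} (a : Vec ℕ n) → Dec (IsInversionSequence a)
isInv? a = all? (λ i → lookup a i <? suc (toℕ i))

avoids? : ∀ {n} (a : Vec ℕ n) → Dec (Avoids a)
avoids? a = all? λ i → all? λ j → all? λ k →
  (toℕ i <? toℕ j) →-dec ((toℕ j <? toℕ k) →-dec ¬? (lookup a k <? lookup a i))

allVecs : (m n : ℕ) → List (Vec ℕ n)
allVecs m zero    = [ [] ]
allVecs m (suc n) = concatMap (λ x → map (x ∷_) (allVecs m n)) (upTo m)

-- every inversion sequence of length n has entries < n (for n ≥ 1);
-- for n = 0 the only vector is the empty one, so I 0 = 1.
I : ℕ → ℕ
I n = length (filter (λ a → isInv? a ×-dec avoids? a) (allVecs n n))

PS : Set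
PS = ℕ → ℤ

const : ℤ → PS
const c zero    = c
const c (suc _) = + 0

z : PS
z zero          = + 0
z (suc zero)    = + 1
z (suc (suc _)) = + 0

infixl 6 _⊕_ _⊖_
infixl 7 _⊛_

_⊕_ : PS → PS → PS
(f ⊕ g) n = f n ℤ.+ g n

_⊖_ : PS → PS → PS
(f ⊖ g) n = f n ℤ.- g n

_⊛_ : PS → PS → PS
(f ⊛ g) n = foldr ℤ._+_ (+ 0) (map (λ i → f i ℤ.* g (n ℕ.∸ i)) (upTo (suc n)))

one : PS
one = const (+ 1)

two : PS
two = const (+ 2)

GF : PS
GF n = + I n

{-# OPTIONS --safe #-}
module Submission where

-- An inversion sequence avoids 100, 110, 120, 201 and 210 iff each entry is at
-- least every entry two or more places before it.  Built left to right, the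
-- number of ways to finish such a sequence depends only on how many values the
-- next entry may take and on whether the last entry lies below the maximum of
-- the earlier ones; this gives a two-family recursion F, G with
-- I (n + 1) = F 0 n.  Its generating function W = Σ I (n + 1) zⁿ is found by a
-- dual form of the kernel method: with u = zX, the weights (1 - u)², z(1 - u)uᵍ
-- and z²uᵍ pair against F g and G g so that one step of the recursion only
-- shifts the pairing.  Summing over g gives (1 - u)² (W (1 - z - u) - 1) = z Φ(X),
-- where Φ(X) = 0 is the equation defining X.  Hence W = 1 / (1 - z - zX), and
-- the theorem is a rearrangement of GF = 1 + zW.

open import Defs
open import Data.Nat using (ℕ)
open import Data.Integer using (+_)
open import Relation.Binary.PropositionalEquality using (_≡_)

open import Algebra.Bundles using (CommutativeSemiring; CommutativeRing)
open import Data.Bool.Base using (if_then_else_)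
open import Data.Nat as ℕ using (zero; suc; _≤_; _<_; _∸_; _⊔_; _≤ᵇ_; _≤?_; z≤n; s≤s; z<s; s<s)
import Data.Nat.Properties as ℕₚ
import Data.Integer as ℤ
import Data.Integer.Properties as ℤₚ
open import Data.Product using (_×_; _,_)
open import Data.Sum using (inj₁; inj₂)
open import Function.Base using (id; _∘_)
open import Relation.Binary.PropositionalEquality as ≡ using (_≗_)
open import Relation.Nullary.Decidable using (dec-true; dec-false)

module FiniteSum {r ℓ} (R : CommutativeSemiring r ℓ) where

  open CommutativeSemiring R
  open import Algebra.Properties.CommutativeSemigroup +-commutativeSemigroup using (interchange)
  open import Relation.Binary.Reasoning.Setoid setoid

  ∑< : ℕ → (ℕ → Carrier) → Carrier
  ∑< zero    f = 0#
  ∑< (suc n) f = ∑< n f + f n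

  infixl 10 ∑<
  syntax ∑< n (λ i → e) = ∑[ i < n ] e

  ∑-cong : ∀ n {f g : ℕ → Carrier} → (∀ i → i < n → f i ≈ g i) → ∑< n f ≈ ∑< n g
  ∑-cong zero    f≈g = refl
  ∑-cong (suc n) f≈g = +-cong (∑-cong n (λ i i<n → f≈g i (ℕₚ.m<n⇒m<1+n i<n))) (f≈g n (ℕₚ.n<1+n n))

  ∑-zero : ∀ n {f : ℕ → Carrier} → (∀ i → i < n → f i ≈ 0#) → ∑< n f ≈ 0#
  ∑-zero zero    f≈0 = refl
  ∑-zero (suc n) f≈0 = begin
    ∑< n _ + _ ≈⟨ +-cong (∑-zero n (λ i i<n → f≈0 i (ℕₚ.m<n⇒m<1+n i<n))) (f≈0 n (ℕₚ.n<1+n n)) ⟩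
    0# + 0#    ≈⟨ +-identityˡ 0# ⟩
    0#         ∎

  ∑-distrib-+ : ∀ n (f g : ℕ → Carrier) → ∑[ i < n ] (f i + g i) ≈ ∑< n f + ∑< n g
  ∑-distrib-+ zero    f g = sym (+-identityˡ 0#)
  ∑-distrib-+ (suc n) f g = begin
    ∑[ i < n ] (f i + g i) + (f n + g n) ≈⟨ +-congʳ (∑-distrib-+ n f g) ⟩
    (∑< n f + ∑< n g) + (f n + g n)      ≈⟨ interchange _ _ _ _ ⟩
    (∑< n f + f n) + (∑< n g + g n)      ∎

  *-distribˡ-∑ : ∀ n a (f : ℕ → Carrier) → ∑[ i < n ] (a * f i) ≈ a * ∑< n f
  *-distribˡ-∑ zero    a f = sym (zeroʳ a)
  *-distribˡ-∑ (suc n) a f = begin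
    ∑[ i < n ] (a * f i) + a * f n ≈⟨ +-congʳ (*-distribˡ-∑ n a f) ⟩
    a * ∑< n f + a * f n           ≈⟨ distribˡ a _ _ ⟨
    a * (∑< n f + f n)             ∎

  ∑-head : ∀ n (f : ℕ → Carrier) → ∑< (suc n) f ≈ f 0 + ∑[ i < n ] f (suc i)
  ∑-head zero    f = +-comm 0# (f 0)
  ∑-head (suc n) f = begin
    ∑< (suc n) f + f (suc n)                    ≈⟨ +-congʳ (∑-head n f) ⟩
    (f 0 + ∑[ i < n ] f (suc i)) + f (suc n)    ≈⟨ +-assoc _ _ _ ⟩
    f 0 + ∑[ i < suc n ] f (suc i)              ∎

  ∑-split : ∀ m n (f : ℕ → Carrier) → ∑< (m ℕ.+ n) f ≈ ∑< m f + ∑[ i < n ] f (m ℕ.+ i)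
  ∑-split m zero    f = begin
    ∑< (m ℕ.+ 0) f ≡⟨ ≡.cong (λ k → ∑< k f) (ℕₚ.+-identityʳ m) ⟩
    ∑< m f         ≈⟨ +-identityʳ _ ⟨
    ∑< m f + 0#    ∎
  ∑-split m (suc n) f = begin
    ∑< (m ℕ.+ suc n) f                                   ≡⟨ ≡.cong (λ k → ∑< k f) (ℕₚ.+-suc m n) ⟩
    ∑< (m ℕ.+ n) f + f (m ℕ.+ n)                         ≈⟨ +-congʳ (∑-split m n f) ⟩
    (∑< m f + ∑[ i < n ] f (m ℕ.+ i)) + f (m ℕ.+ n)     ≈⟨ +-assoc _ _ _ ⟩
    ∑< m f + ∑[ i < suc n ] f (m ℕ.+ i)                 ∎

  ∑-reverse : ∀ N (f : ℕ → Carrier) → ∑[ t < suc N ] f (N ∸ t) ≈ ∑< (suc N) f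
  ∑-reverse zero    f = refl
  ∑-reverse (suc N) f = begin
    ∑[ t < suc (suc N) ] f (suc N ∸ t)   ≈⟨ ∑-head (suc N) _ ⟩
    f (suc N) + ∑[ t < suc N ] f (N ∸ t) ≈⟨ +-congˡ (∑-reverse N f) ⟩
    f (suc N) + ∑< (suc N) f             ≈⟨ +-comm _ _ ⟩
    ∑< (suc (suc N)) f                   ∎

  ∑-restrict-≥ : ∀ p k (f : ℕ → Carrier) →
           ∑[ x < p ℕ.+ k ] (if p ≤ᵇ x then f x else 0#) ≈ ∑[ t < k ] f (p ℕ.+ t)
  ∑-restrict-≥ p k f = begin
    ∑[ x < p ℕ.+ k ] (if p ≤ᵇ x then f x else 0#)                               ≈⟨ ∑-split p k _ ⟩
    ∑[ x < p ] (if p ≤ᵇ x then f x else 0#) + ∑[ t < k ] (if p ≤ᵇ p ℕ.+ t then f (p ℕ.+ t) else 0#)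
      ≈⟨ +-cong (∑-zero p below) (∑-cong k above) ⟩
    0# + ∑[ t < k ] f (p ℕ.+ t)                                                  ≈⟨ +-identityˡ _ ⟩
    ∑[ t < k ] f (p ℕ.+ t)                                                       ∎
    where
    below : ∀ x → x < p → (if p ≤ᵇ x then f x else 0#) ≈ 0#
    below x x<p rewrite dec-false (p ≤? x) (ℕₚ.<⇒≱ x<p) = refl
    above : ∀ t → t < k → (if p ≤ᵇ p ℕ.+ t then f (p ℕ.+ t) else 0#) ≈ f (p ℕ.+ t)
    above t _ rewrite dec-true (p ≤? p ℕ.+ t) (ℕₚ.m≤m+n p t) = refl

  ∑-restrict-≤ : ∀ N c (f : ℕ → Carrier) → c < N →
           ∑[ x < N ] (if x ≤ᵇ c then f x else 0#) ≈ ∑< (suc c) f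
  ∑-restrict-≤ N c f c<N = begin
    ∑[ x < N ] g x
      ≡⟨ ≡.cong (λ k → ∑< k g) (ℕₚ.m+[n∸m]≡n c<N) ⟨
    ∑[ x < suc c ℕ.+ (N ∸ suc c) ] g x
      ≈⟨ ∑-split (suc c) (N ∸ suc c) g ⟩
    ∑< (suc c) g + ∑[ t < N ∸ suc c ] g (suc c ℕ.+ t)
      ≈⟨ +-cong (∑-cong (suc c) kept) (∑-zero (N ∸ suc c) dropped) ⟩
    ∑< (suc c) f + 0#
      ≈⟨ +-identityʳ _ ⟩
    ∑< (suc c) f ∎
    where
    g : ℕ → Carrier
    g x = if x ≤ᵇ c then f x else 0#
    kept : ∀ x → x < suc c → g x ≈ f x
    kept x x<1+c rewrite dec-true (x ≤? c) (ℕₚ.≤-pred x<1+c) = refl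
    dropped : ∀ t → t < N ∸ suc c → g (suc c ℕ.+ t) ≈ 0#
    dropped t _ rewrite dec-false (suc c ℕ.+ t ≤? c) (ℕₚ.<⇒≱ (ℕₚ.m≤m+n (suc c) t)) = refl

module NatSum where

  open import Data.Nat using (_+_; _*_)
  open FiniteSum ℕₚ.+-*-commutativeSemiring public
  open ≡.≡-Reasoning

  ∑-const : ∀ n {f : ℕ → ℕ} c → (∀ i → i < n → f i ≡ c) → ∑< n f ≡ n * c
  ∑-const zero    c f≡c = ≡.refl
  ∑-const (suc n) c f≡c =
    ≡.trans (≡.cong₂ _+_ (∑-const n c (λ i i<n → f≡c i (ℕₚ.m<n⇒m<1+n i<n))) (f≡c n (ℕₚ.n<1+n n)))
            (ℕₚ.+-comm (n * c) c)

  ∑-reverse-weighted : ∀ N (h : ℕ → ℕ) →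
    ∑[ t < suc N ] (t * h (suc (N ∸ t))) ≡ ∑[ g < suc N ] ∑[ i < g ] h (suc i)
  ∑-reverse-weighted zero    h = ≡.refl
  ∑-reverse-weighted (suc N) h = begin
    ∑[ t < suc (suc N) ] (t * h (suc (suc N ∸ t)))
      ≡⟨ ∑-head (suc N) _ ⟩
    ∑[ t < suc N ] (suc t * h (suc (N ∸ t)))
      ≡⟨ ∑-distrib-+ (suc N) (λ t → h (suc (N ∸ t))) (λ t → t * h (suc (N ∸ t))) ⟩
    ∑[ t < suc N ] h (suc (N ∸ t)) + ∑[ t < suc N ] (t * h (suc (N ∸ t)))
      ≡⟨ ≡.cong₂ _+_ (∑-reverse N (h ∘ suc)) (∑-reverse-weighted N h) ⟩
    ∑[ i < suc N ] h (suc i) + ∑[ g < suc N ] ∑[ i < g ] h (suc i)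
      ≡⟨ ℕₚ.+-comm (∑[ i < suc N ] h (suc i)) _ ⟩
    ∑[ g < suc (suc N) ] ∑[ i < g ] h (suc i) ∎

module IntSum where

  open import Data.Integer using (ℤ; +_; _+_; _*_; _-_)
  open import Data.Integer.Tactic.RingSolver using (solve-∀)
  open FiniteSum ℤₚ.+-*-commutativeSemiring public
  open ≡.≡-Reasoning

  pos-∑ : ∀ n (f : ℕ → ℕ) → + NatSum.∑< n f ≡ ∑[ i < n ] (+ f i)
  pos-∑ zero    f = ≡.refl
  pos-∑ (suc n) f = ≡.trans (ℤₚ.pos-+ (NatSum.∑< n f) (f n)) (≡.cong (_+ + f n) (pos-∑ n f))

  ∑-telescope : ∀ n (y : ℕ → ℤ) → ∑[ g < n ] (y g - y (suc g)) ≡ y 0 - y n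
  ∑-telescope zero    y = ≡.sym (ℤₚ.+-inverseʳ (y 0))
  ∑-telescope (suc n) y =
    ≡.trans (≡.cong (_+ (y n - y (suc n))) (∑-telescope n y)) (cancel (y 0) (y n) (y (suc n)))
    where
    cancel : ∀ a b c → a - b + (b - c) ≡ a - c
    cancel = solve-∀

  ∑-by-parts : ∀ N (p u : ℕ → ℤ) →
    ∑[ g < suc N ] (p g * u g) ≡
    ∑[ g < suc N ] ((p g - p (suc g)) * ∑[ i < suc g ] u i) + p (suc N) * ∑[ i < suc N ] u i
  ∑-by-parts zero    p u = regroup (p 0) (p 1) (u 0)
    where
    regroup : ∀ a b c → + 0 + a * c ≡ + 0 + (a - b) * (+ 0 + c) + b * (+ 0 + c)
    regroup = solve-∀
  ∑-by-parts (suc N) p u = begin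
    ∑[ g < suc N ] (p g * u g) + p (suc N) * u (suc N)
      ≡⟨ ≡.cong (_+ p (suc N) * u (suc N)) (∑-by-parts N p u) ⟩
    A + p (suc N) * U + p (suc N) * u (suc N)
      ≡⟨ regroup A (p (suc N)) (p (suc (suc N))) U (u (suc N)) ⟩
    A + (p (suc N) - p (suc (suc N))) * (U + u (suc N)) + p (suc (suc N)) * (U + u (suc N)) ∎
    where
    A U : ℤ
    A = ∑[ g < suc N ] ((p g - p (suc g)) * ∑[ i < suc g ] u i)
    U = ∑[ i < suc N ] u i
    regroup : ∀ A a b U v → A + a * U + a * v ≡ A + (a - b) * (U + v) + b * (U + v)
    regroup = solve-∀

module PowerSeries where

  open import Algebra.Structures using (IsCommutativeRing)
  import Algebra.Solver.Ring
  import Relation.Binary.Reasoning.Setoid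
  open import Algebra.Solver.Ring.AlmostCommutativeRing
    using (fromCommutativeRing; _-Raw-AlmostCommutative⟶_)
  import Algebra.Construct.Pointwise ℕ as Pointwise
  open import Data.Integer as ℤ using (ℤ; +_; _+_; _*_; -_)
  open import Data.Integer.Tactic.RingSolver using (solve-∀)
  open import Data.List using (foldr; map; applyUpTo)
  open import Data.List.Properties using (map-applyUpTo)
  open import Data.Maybe using (Maybe; just; nothing)
  open import Relation.Nullary.Decidable using (yes; no)
  open IntSum using (∑<; ∑-cong; ∑-distrib-+; *-distribˡ-∑)
  open ≡.≡-Reasoning

  -- Constant in n rather than const (+ 0), so that 0ₚ n reduces and
  -- Algebra.Construct.Pointwise supplies the additive group.
  0ₚ : PS
  0ₚ _ = + 0

  -ₚ_ : PS → PS
  (-ₚ f) n = - f n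

  shift : PS → PS
  shift f n = f (suc n)

  infixr 8 _·_
  _·_ : ℤ → PS → PS
  (a · f) n = a * f n

  ⊛-coeff-0 : ∀ f g → (f ⊛ g) 0 ≡ f 0 * g 0
  ⊛-coeff-0 f g = ℤₚ.+-identityʳ (f 0 * g 0)

  ⊛-coeff-suc : ∀ f g n → (f ⊛ g) (suc n) ≡ f 0 * g (suc n) + (shift f ⊛ g) n
  ⊛-coeff-suc f g n = ≡.cong (λ xs → f 0 * g (suc n) + foldr _+_ (+ 0) xs) (begin
    map term (applyUpTo suc (suc n))          ≡⟨ map-applyUpTo suc term (suc n) ⟩
    applyUpTo (term ∘ suc) (suc n)            ≡⟨ map-applyUpTo id (term ∘ suc) (suc n) ⟨
    map (term ∘ suc) (applyUpTo id (suc n))   ∎)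
    where
    term : ℕ → ℤ
    term i = f i * g (suc n ∸ i)

  ⊛-coeff-sucʳ : ∀ f g n → (f ⊛ g) (suc n) ≡ (f ⊛ shift g) n + f (suc n) * g 0
  ⊛-coeff-sucʳ f g zero = begin
    (f ⊛ g) 1                      ≡⟨ ⊛-coeff-suc f g 0 ⟩
    f 0 * g 1 + (shift f ⊛ g) 0    ≡⟨ ≡.cong₂ _+_ (≡.sym (⊛-coeff-0 f (shift g))) (⊛-coeff-0 (shift f) g) ⟩
    (f ⊛ shift g) 0 + f 1 * g 0    ∎
  ⊛-coeff-sucʳ f g (suc n) = begin
    (f ⊛ g) (suc (suc n))
      ≡⟨ ⊛-coeff-suc f g (suc n) ⟩
    f 0 * g (suc (suc n)) + (shift f ⊛ g) (suc n)
      ≡⟨ ≡.cong (_+_ (f 0 * g (suc (suc n)))) (⊛-coeff-sucʳ (shift f) g n) ⟩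
    f 0 * g (suc (suc n)) + ((shift f ⊛ shift g) n + f (suc (suc n)) * g 0)
      ≡⟨ ℤₚ.+-assoc (f 0 * g (suc (suc n))) ((shift f ⊛ shift g) n) (f (suc (suc n)) * g 0) ⟨
    f 0 * g (suc (suc n)) + (shift f ⊛ shift g) n + f (suc (suc n)) * g 0
      ≡⟨ ≡.cong (_+ f (suc (suc n)) * g 0) (⊛-coeff-suc f (shift g) n) ⟨
    (f ⊛ shift g) (suc n) + f (suc (suc n)) * g 0 ∎

  ⊛-cong : ∀ {f f′ g g′} → f ≗ f′ → g ≗ g′ → f ⊛ g ≗ f′ ⊛ g′
  ⊛-cong {f} {f′} {g} {g′} f≗f′ g≗g′ zero = begin
    (f ⊛ g) 0     ≡⟨ ⊛-coeff-0 f g ⟩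
    f 0 * g 0     ≡⟨ ≡.cong₂ _*_ (f≗f′ 0) (g≗g′ 0) ⟩
    f′ 0 * g′ 0   ≡⟨ ⊛-coeff-0 f′ g′ ⟨
    (f′ ⊛ g′) 0   ∎
  ⊛-cong {f} {f′} {g} {g′} f≗f′ g≗g′ (suc n) = begin
    (f ⊛ g) (suc n)                      ≡⟨ ⊛-coeff-suc f g n ⟩
    f 0 * g (suc n) + (shift f ⊛ g) n    ≡⟨ ≡.cong₂ _+_ (≡.cong₂ _*_ (f≗f′ 0) (g≗g′ (suc n)))
                                                       (⊛-cong (f≗f′ ∘ suc) g≗g′ n) ⟩
    f′ 0 * g′ (suc n) + (shift f′ ⊛ g′) n ≡⟨ ⊛-coeff-suc f′ g′ n ⟨
    (f′ ⊛ g′) (suc n)                    ∎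

  ⊛-zeroˡ : ∀ {g} → g ≗ 0ₚ → ∀ f → g ⊛ f ≗ 0ₚ
  ⊛-zeroˡ {g} g≗0 f zero = begin
    (g ⊛ f) 0   ≡⟨ ⊛-coeff-0 g f ⟩
    g 0 * f 0   ≡⟨ ≡.cong (_* f 0) (g≗0 0) ⟩
    + 0         ∎
  ⊛-zeroˡ {g} g≗0 f (suc n) = begin
    (g ⊛ f) (suc n)                     ≡⟨ ⊛-coeff-suc g f n ⟩
    g 0 * f (suc n) + (shift g ⊛ f) n   ≡⟨ ≡.cong₂ _+_ (≡.cong (_* f (suc n)) (g≗0 0))
                                                       (⊛-zeroˡ (g≗0 ∘ suc) f n) ⟩
    + 0                                 ∎

  shift-const : ∀ c → shift (const c) ≗ 0ₚ
  shift-const c _ = ≡.refl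

  ⊛-identityˡ : ∀ f → one ⊛ f ≗ f
  ⊛-identityˡ f zero = ≡.trans (⊛-coeff-0 one f) (ℤₚ.*-identityˡ (f 0))
  ⊛-identityˡ f (suc n) = begin
    (one ⊛ f) (suc n)                       ≡⟨ ⊛-coeff-suc one f n ⟩
    + 1 * f (suc n) + (shift one ⊛ f) n     ≡⟨ ≡.cong₂ _+_ (ℤₚ.*-identityˡ (f (suc n)))
                                                           (⊛-zeroˡ (shift-const (+ 1)) f n) ⟩
    f (suc n) + + 0                         ≡⟨ ℤₚ.+-identityʳ (f (suc n)) ⟩
    f (suc n)                               ∎

  ⊛-comm : ∀ f g → f ⊛ g ≗ g ⊛ f
  ⊛-comm f g zero = begin
    (f ⊛ g) 0   ≡⟨ ⊛-coeff-0 f g ⟩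
    f 0 * g 0   ≡⟨ ℤₚ.*-comm (f 0) (g 0) ⟩
    g 0 * f 0   ≡⟨ ⊛-coeff-0 g f ⟨
    (g ⊛ f) 0   ∎
  ⊛-comm f g (suc n) = begin
    (f ⊛ g) (suc n)                     ≡⟨ ⊛-coeff-suc f g n ⟩
    f 0 * g (suc n) + (shift f ⊛ g) n   ≡⟨ ≡.cong₂ _+_ (ℤₚ.*-comm (f 0) (g (suc n))) (⊛-comm (shift f) g n) ⟩
    g (suc n) * f 0 + (g ⊛ shift f) n   ≡⟨ ℤₚ.+-comm (g (suc n) * f 0) ((g ⊛ shift f) n) ⟩
    (g ⊛ shift f) n + g (suc n) * f 0   ≡⟨ ⊛-coeff-sucʳ g f n ⟨
    (g ⊛ f) (suc n)                     ∎

  ⊛-distribʳ : ∀ h f g → (f ⊕ g) ⊛ h ≗ f ⊛ h ⊕ g ⊛ h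
  ⊛-distribʳ h f g zero = begin
    ((f ⊕ g) ⊛ h) 0         ≡⟨ ⊛-coeff-0 (f ⊕ g) h ⟩
    (f 0 + g 0) * h 0       ≡⟨ ℤₚ.*-distribʳ-+ (h 0) (f 0) (g 0) ⟩
    f 0 * h 0 + g 0 * h 0   ≡⟨ ≡.cong₂ _+_ (⊛-coeff-0 f h) (⊛-coeff-0 g h) ⟨
    (f ⊛ h ⊕ g ⊛ h) 0       ∎
  ⊛-distribʳ h f g (suc n) = begin
    ((f ⊕ g) ⊛ h) (suc n)
      ≡⟨ ⊛-coeff-suc (f ⊕ g) h n ⟩
    (f 0 + g 0) * h (suc n) + (shift (f ⊕ g) ⊛ h) n
      ≡⟨ ≡.cong₂ _+_ (ℤₚ.*-distribʳ-+ (h (suc n)) (f 0) (g 0)) (⊛-distribʳ h (shift f) (shift g) n) ⟩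
    (f 0 * h (suc n) + g 0 * h (suc n)) + ((shift f ⊛ h) n + (shift g ⊛ h) n)
      ≡⟨ interchange (f 0 * h (suc n)) (g 0 * h (suc n)) ((shift f ⊛ h) n) ((shift g ⊛ h) n) ⟩
    (f 0 * h (suc n) + (shift f ⊛ h) n) + (g 0 * h (suc n) + (shift g ⊛ h) n)
      ≡⟨ ≡.cong₂ _+_ (⊛-coeff-suc f h n) (⊛-coeff-suc g h n) ⟨
    (f ⊛ h ⊕ g ⊛ h) (suc n) ∎
    where
    interchange : ∀ a b c d → (a + b) + (c + d) ≡ (a + c) + (b + d)
    interchange = solve-∀

  ·-⊛ : ∀ a f g → (a · f) ⊛ g ≗ a · (f ⊛ g)
  ·-⊛ a f g zero = begin
    ((a · f) ⊛ g) 0   ≡⟨ ⊛-coeff-0 (a · f) g ⟩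
    a * f 0 * g 0     ≡⟨ ℤₚ.*-assoc a (f 0) (g 0) ⟩
    a * (f 0 * g 0)   ≡⟨ ≡.cong (a *_) (⊛-coeff-0 f g) ⟨
    a * (f ⊛ g) 0     ∎
  ·-⊛ a f g (suc n) = begin
    ((a · f) ⊛ g) (suc n)                              ≡⟨ ⊛-coeff-suc (a · f) g n ⟩
    a * f 0 * g (suc n) + ((a · shift f) ⊛ g) n        ≡⟨ ≡.cong₂ _+_ (ℤₚ.*-assoc a (f 0) (g (suc n)))
                                                                      (·-⊛ a (shift f) g n) ⟩
    a * (f 0 * g (suc n)) + a * (shift f ⊛ g) n        ≡⟨ ℤₚ.*-distribˡ-+ a (f 0 * g (suc n)) ((shift f ⊛ g) n) ⟨
    a * (f 0 * g (suc n) + (shift f ⊛ g) n)            ≡⟨ ≡.cong (a *_) (⊛-coeff-suc f g n) ⟨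
    a * (f ⊛ g) (suc n)                                ∎

  ⊛-assoc : ∀ f g h → (f ⊛ g) ⊛ h ≗ f ⊛ (g ⊛ h)
  ⊛-assoc f g h zero = begin
    ((f ⊛ g) ⊛ h) 0     ≡⟨ ⊛-coeff-0 (f ⊛ g) h ⟩
    (f ⊛ g) 0 * h 0     ≡⟨ ≡.cong (_* h 0) (⊛-coeff-0 f g) ⟩
    f 0 * g 0 * h 0     ≡⟨ ℤₚ.*-assoc (f 0) (g 0) (h 0) ⟩
    f 0 * (g 0 * h 0)   ≡⟨ ≡.cong (f 0 *_) (⊛-coeff-0 g h) ⟨
    f 0 * (g ⊛ h) 0     ≡⟨ ⊛-coeff-0 f (g ⊛ h) ⟨
    (f ⊛ (g ⊛ h)) 0     ∎
  ⊛-assoc f g h (suc n) = begin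
    ((f ⊛ g) ⊛ h) (suc n)
      ≡⟨ ⊛-coeff-suc (f ⊛ g) h n ⟩
    (f ⊛ g) 0 * h (suc n) + (shift (f ⊛ g) ⊛ h) n
      ≡⟨ ≡.cong₂ _+_ (≡.cong (_* h (suc n)) (⊛-coeff-0 f g)) (⊛-cong {g = h} shift-⊛ (λ _ → ≡.refl) n) ⟩
    f 0 * g 0 * h (suc n) + ((shift f ⊛ g ⊕ f 0 · shift g) ⊛ h) n
      ≡⟨ ≡.cong (_+_ (f 0 * g 0 * h (suc n))) (⊛-distribʳ h (shift f ⊛ g) (f 0 · shift g) n) ⟩
    f 0 * g 0 * h (suc n) + (((shift f ⊛ g) ⊛ h) n + ((f 0 · shift g) ⊛ h) n)
      ≡⟨ ≡.cong (_+_ (f 0 * g 0 * h (suc n)))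
                (≡.cong₂ _+_ (⊛-assoc (shift f) g h n) (·-⊛ (f 0) (shift g) h n)) ⟩
    f 0 * g 0 * h (suc n) + ((shift f ⊛ (g ⊛ h)) n + f 0 * (shift g ⊛ h) n)
      ≡⟨ regroup (f 0) (g 0) (h (suc n)) ((shift f ⊛ (g ⊛ h)) n) ((shift g ⊛ h) n) ⟩
    f 0 * (g 0 * h (suc n) + (shift g ⊛ h) n) + (shift f ⊛ (g ⊛ h)) n
      ≡⟨ ≡.cong (λ x → f 0 * x + (shift f ⊛ (g ⊛ h)) n) (⊛-coeff-suc g h n) ⟨
    f 0 * (g ⊛ h) (suc n) + (shift f ⊛ (g ⊛ h)) n
      ≡⟨ ⊛-coeff-suc f (g ⊛ h) n ⟨
    (f ⊛ (g ⊛ h)) (suc n) ∎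
    where
    shift-⊛ : shift (f ⊛ g) ≗ shift f ⊛ g ⊕ f 0 · shift g
    shift-⊛ n = ≡.trans (⊛-coeff-suc f g n) (ℤₚ.+-comm (f 0 * g (suc n)) ((shift f ⊛ g) n))
    regroup : ∀ a b c d e → a * b * c + (d + a * e) ≡ a * (b * c + e) + d
    regroup = solve-∀

  isCommutativeRing : IsCommutativeRing _≗_ _⊕_ _⊛_ -ₚ_ 0ₚ one
  isCommutativeRing = record
    { isRing = record
      { +-isAbelianGroup = Pointwise.isAbelianGroup ℤₚ.+-0-isAbelianGroup
      ; *-cong           = ⊛-cong
      ; *-assoc          = ⊛-assoc
      ; *-identity       = ⊛-identityˡ , λ f n → ≡.trans (⊛-comm f one n) (⊛-identityˡ f n)
      ; distrib          = (λ h f g n → ≡.trans (⊛-comm h (f ⊕ g) n)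
                                       (≡.trans (⊛-distribʳ h f g n) (≡.cong₂ _+_ (⊛-comm f h n) (⊛-comm g h n))))
                         , ⊛-distribʳ
      }
    ; *-comm = ⊛-comm
    }

  commutativeRing : CommutativeRing _ _
  commutativeRing = record { isCommutativeRing = isCommutativeRing }

  module ≗-Reasoning = Relation.Binary.Reasoning.Setoid (CommutativeRing.setoid commutativeRing)

  const-*-homo : ∀ a b → const (a * b) ≗ const a ⊛ const b
  const-*-homo a b zero    = ≡.sym (⊛-coeff-0 (const a) (const b))
  const-*-homo a b (suc n) = ≡.sym (begin
    (const a ⊛ const b) (suc n)               ≡⟨ ⊛-coeff-suc (const a) (const b) n ⟩
    a * + 0 + (shift (const a) ⊛ const b) n   ≡⟨ ≡.cong₂ _+_ (ℤₚ.*-zeroʳ a)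
                                                             (⊛-zeroˡ (shift-const a) (const b) n) ⟩
    + 0                                       ∎)

  const-homomorphism : CommutativeRing.rawRing ℤₚ.+-*-commutativeRing
                         -Raw-AlmostCommutative⟶ fromCommutativeRing commutativeRing
  const-homomorphism = record
    { ⟦_⟧    = const
    ; +-homo = λ { a b zero → ≡.refl ; a b (suc n) → ≡.refl }
    ; *-homo = const-*-homo
    ; -‿homo = λ { a zero → ≡.refl ; a (suc n) → ≡.refl }
    ; 0-homo = λ { zero → ≡.refl ; (suc n) → ≡.refl }
    ; 1-homo = λ { zero → ≡.refl ; (suc n) → ≡.refl }
    }

  const-≟ : ∀ a b → Maybe (const a ≗ const b)
  const-≟ a b with a ℤ.≟ b
  ... | yes ≡.refl = just (λ _ → ≡.refl)
  ... | no _       = nothing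

  -- f ⊖ g is definitionally f ⊕ (-ₚ g), so the solver's identities apply to
  -- expressions written with _⊖_.
  module Solver = Algebra.Solver.Ring (CommutativeRing.rawRing ℤₚ.+-*-commutativeRing)
                    (fromCommutativeRing commutativeRing) const-homomorphism const-≟

  z⊛-coeff-0 : ∀ f → (z ⊛ f) 0 ≡ + 0
  z⊛-coeff-0 f = ⊛-coeff-0 z f

  z⊛-coeff-suc : ∀ f n → (z ⊛ f) (suc n) ≡ f n
  z⊛-coeff-suc f n = begin
    (z ⊛ f) (suc n)                       ≡⟨ ⊛-coeff-suc z f n ⟩
    + 0 * f (suc n) + (shift z ⊛ f) n     ≡⟨ ℤₚ.+-identityˡ _ ⟩
    (shift z ⊛ f) n                       ≡⟨ ⊛-cong {g = f} shift-z (λ _ → ≡.refl) n ⟩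
    (one ⊛ f) n                           ≡⟨ ⊛-identityˡ f n ⟩
    f n                                   ∎
    where
    shift-z : shift z ≗ one
    shift-z zero    = ≡.refl
    shift-z (suc _) = ≡.refl

  HasOrder : ℕ → PS → Set
  HasOrder k f = ∀ i → i < k → f i ≡ + 0

  HasOrder-suc : ∀ {k f} → HasOrder k f → f k ≡ + 0 → HasOrder (suc k) f
  HasOrder-suc {k} f<k fk≡0 i i<1+k with ℕₚ.m<1+n⇒m<n∨m≡n i<1+k
  ... | inj₁ i<k    = f<k i i<k
  ... | inj₂ ≡.refl = fk≡0

  z⊛-hasOrder : ∀ f → HasOrder 1 (z ⊛ f)
  z⊛-hasOrder f zero    _         = z⊛-coeff-0 f
  z⊛-hasOrder f (suc i) (s<s ())

  ⊛-hasOrder : ∀ p q {f g} → HasOrder p f → HasOrder q g → HasOrder (p ℕ.+ q) (f ⊛ g)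
  ⊛-hasOrder (suc p) q {f} {g} f<p g<q zero _ = begin
    (f ⊛ g) 0   ≡⟨ ⊛-coeff-0 f g ⟩
    f 0 * g 0   ≡⟨ ≡.cong (_* g 0) (f<p 0 z<s) ⟩
    + 0         ∎
  ⊛-hasOrder (suc p) q {f} {g} f<p g<q (suc n) (s<s n<p+q) = begin
    (f ⊛ g) (suc n)                     ≡⟨ ⊛-coeff-suc f g n ⟩
    f 0 * g (suc n) + (shift f ⊛ g) n   ≡⟨ ≡.cong₂ _+_ (≡.cong (_* g (suc n)) (f<p 0 z<s))
                                                       (⊛-hasOrder p q (λ i → f<p (suc i) ∘ s<s) g<q n n<p+q) ⟩
    + 0                                 ∎
  ⊛-hasOrder zero (suc q) {f} {g} f<p g<q zero _ = begin
    (f ⊛ g) 0   ≡⟨ ⊛-coeff-0 f g ⟩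
    f 0 * g 0   ≡⟨ ≡.cong (f 0 *_) (g<q 0 z<s) ⟩
    f 0 * + 0   ≡⟨ ℤₚ.*-zeroʳ (f 0) ⟩
    + 0         ∎
  ⊛-hasOrder zero (suc q) {f} {g} f<p g<q (suc n) (s<s n<q) = begin
    (f ⊛ g) (suc n)                     ≡⟨ ⊛-coeff-sucʳ f g n ⟩
    (f ⊛ shift g) n + f (suc n) * g 0   ≡⟨ ≡.cong₂ _+_ (⊛-hasOrder 0 q f<p (λ i → g<q (suc i) ∘ s<s) n n<q)
                                                       (≡.trans (≡.cong (f (suc n) *_) (g<q 0 z<s))
                                                                (ℤₚ.*-zeroʳ (f (suc n)))) ⟩
    + 0                                 ∎

  ⊛-cancel-unit : ∀ {f g} → g 0 ≡ + 1 → f ⊛ g ≗ 0ₚ → f ≗ 0ₚ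
  ⊛-cancel-unit {f} {g} g0≡1 fg≗0 n = f-hasOrder (suc n) n (ℕₚ.n<1+n n)
    where
    next-coeff : ∀ k → HasOrder k f → f k ≡ + 0
    next-coeff zero _ = begin
      f 0           ≡⟨ ℤₚ.*-identityʳ (f 0) ⟨
      f 0 * + 1     ≡⟨ ≡.cong (f 0 *_) g0≡1 ⟨
      f 0 * g 0     ≡⟨ ⊛-coeff-0 f g ⟨
      (f ⊛ g) 0     ≡⟨ fg≗0 0 ⟩
      + 0           ∎
    next-coeff (suc k) f<k = begin
      f (suc k)                                 ≡⟨ ℤₚ.*-identityʳ (f (suc k)) ⟨
      f (suc k) * + 1                           ≡⟨ ≡.cong (f (suc k) *_) g0≡1 ⟨
      f (suc k) * g 0                           ≡⟨ ℤₚ.+-identityˡ (f (suc k) * g 0) ⟨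
      + 0 + f (suc k) * g 0                     ≡⟨ ≡.cong (_+ f (suc k) * g 0) lower-terms ⟨
      (f ⊛ shift g) k + f (suc k) * g 0         ≡⟨ ⊛-coeff-sucʳ f g k ⟨
      (f ⊛ g) (suc k)                           ≡⟨ fg≗0 (suc k) ⟩
      + 0                                       ∎
      where
      lower-terms : (f ⊛ shift g) k ≡ + 0
      lower-terms = ⊛-hasOrder (suc k) 0 {f} {shift g} f<k (λ _ ()) k
                               (ℕₚ.≤-reflexive (≡.cong suc (≡.sym (ℕₚ.+-identityʳ k))))
    f-hasOrder : ∀ k → HasOrder k f
    f-hasOrder zero    = λ _ ()
    f-hasOrder (suc k) = HasOrder-suc (f-hasOrder k) (next-coeff k (f-hasOrder k))

  ∑ₚ : (ℕ → PS) → PS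
  ∑ₚ Q m = ∑[ g < suc m ] Q g m

  ⊛-∑ₚ : ∀ Q → (∀ g → HasOrder g (Q g)) → ∀ h → h ⊛ ∑ₚ Q ≗ ∑ₚ (λ g → h ⊛ Q g)
  ⊛-∑ₚ Q Q<g h zero = begin
    (h ⊛ ∑ₚ Q) 0            ≡⟨ ⊛-coeff-0 h (∑ₚ Q) ⟩
    h 0 * (+ 0 + Q 0 0)     ≡⟨ ≡.cong (h 0 *_) (ℤₚ.+-identityˡ (Q 0 0)) ⟩
    h 0 * Q 0 0             ≡⟨ ⊛-coeff-0 h (Q 0) ⟨
    (h ⊛ Q 0) 0             ≡⟨ ℤₚ.+-identityˡ _ ⟨
    ∑ₚ (λ g → h ⊛ Q g) 0    ∎
  ⊛-∑ₚ Q Q<g h (suc m) = begin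
    (h ⊛ ∑ₚ Q) (suc m)
      ≡⟨ ⊛-coeff-suc h (∑ₚ Q) m ⟩
    h 0 * ∑ₚ Q (suc m) + (shift h ⊛ ∑ₚ Q) m
      ≡⟨ ≡.cong₂ _+_ (≡.sym (*-distribˡ-∑ (suc (suc m)) (h 0) (λ g → Q g (suc m))))
                     (⊛-∑ₚ Q Q<g (shift h) m) ⟩
    ∑[ g < suc (suc m) ] (h 0 * Q g (suc m)) + ∑[ g < suc m ] (shift h ⊛ Q g) m
      ≡⟨ ≡.cong (_+_ (∑[ g < suc (suc m) ] (h 0 * Q g (suc m)))) extend ⟩
    ∑[ g < suc (suc m) ] (h 0 * Q g (suc m)) + ∑[ g < suc (suc m) ] (shift h ⊛ Q g) m
      ≡⟨ ∑-distrib-+ (suc (suc m)) (λ g → h 0 * Q g (suc m)) (λ g → (shift h ⊛ Q g) m) ⟨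
    ∑[ g < suc (suc m) ] (h 0 * Q g (suc m) + (shift h ⊛ Q g) m)
      ≡⟨ ∑-cong (suc (suc m)) (λ g _ → ⊛-coeff-suc h (Q g) m) ⟨
    ∑ₚ (λ g → h ⊛ Q g) (suc m) ∎
    where
    extend : ∑[ g < suc m ] (shift h ⊛ Q g) m ≡ ∑[ g < suc (suc m) ] (shift h ⊛ Q g) m
    extend = ≡.sym (≡.trans (≡.cong (_+_ (∑[ g < suc m ] (shift h ⊛ Q g) m))
                                   (⊛-hasOrder 0 (suc m) {shift h} (λ _ ()) (Q<g (suc m)) m (ℕₚ.n<1+n m)))
                            (ℤₚ.+-identityʳ _))

  ⊛-zeroʳ : ∀ f {g} → g ≗ 0ₚ → f ⊛ g ≗ 0ₚ
  ⊛-zeroʳ f {g} g≗0 n = ≡.trans (⊛-comm f g n) (⊛-zeroˡ g≗0 f n)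

  ⊕-⊛-zeroʳ : ∀ f g {e} → e ≗ 0ₚ → f ⊕ g ⊛ e ≗ f
  ⊕-⊛-zeroʳ f g e≗0 n = ≡.trans (≡.cong (_+_ (f n)) (⊛-zeroʳ g e≗0 n)) (ℤₚ.+-identityʳ (f n))

open PowerSeries

module Counting where

  open import Data.Bool using (Bool; true; false; T; _∧_)
  open import Data.Bool.Properties using (T-∧)
  open import Data.Fin using (Fin; toℕ) renaming (zero to fzero; suc to fsuc)
  open import Data.List using (List; []; _∷_; _++_; map; concatMap; applyUpTo; length; filter)
  open import Data.Unit using (tt)
  open import Data.Vec using (Vec; []; _∷_; lookup)
  open import Function.Bundles using (Equivalence)
  open import Relation.Nullary using (Dec; yes; no; contradiction)
  open NatSum
  open ≡.≡-Reasoning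

  -- A state (c, p, a) stands for a prefix of length c whose last entry is a and
  -- whose other entries are at most p: the next entry x must satisfy
  -- p ≤ x ≤ c, after which the state is (c + 1, p ⊔ a, x).
  completions : ℕ → ℕ → ℕ → ℕ → ℕ
  completions c p a zero    = 1
  completions c p a (suc m) = ∑[ x < suc c ] (if p ≤ᵇ x then completions (suc c) (p ⊔ a) x m else 0)

  record IsCompletion (c p a : ℕ) {m} (v : Vec ℕ m) : Set where
    field
      bounded : ∀ i → lookup v i ≤ c ℕ.+ toℕ i
      above-p : ∀ i → p ≤ lookup v i
      above-a : ∀ i → 1 ≤ toℕ i → a ≤ lookup v i
      avoids  : Avoids v

  isCompletionᵇ : ∀ {m} → ℕ → ℕ → ℕ → Vec ℕ m → Bool
  isCompletionᵇ c p a []      = true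
  isCompletionᵇ c p a (x ∷ v) = (x ≤ᵇ c) ∧ (p ≤ᵇ x) ∧ isCompletionᵇ (suc c) (p ⊔ a) x v

  IsCompletion-∷⁻ : ∀ {m c p a x} {v : Vec ℕ m} → IsCompletion c p a (x ∷ v) →
                    x ≤ c × p ≤ x × IsCompletion (suc c) (p ⊔ a) x v
  IsCompletion-∷⁻ {c = c} {p} {a} {x} {v} xv =
    ≡.subst (x ≤_) (ℕₚ.+-identityʳ c) (bounded fzero) , above-p fzero , record
      { bounded = λ i → ≡.subst (lookup v i ≤_) (ℕₚ.+-suc c (toℕ i)) (bounded (fsuc i))
      ; above-p = λ i → ℕₚ.⊔-lub (above-p (fsuc i)) (above-a (fsuc i) (s≤s z≤n))
      ; above-a = above-x
      ; avoids  = λ i j k i<j j<k → avoids (fsuc i) (fsuc j) (fsuc k) (s<s i<j) (s<s j<k)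
      }
    where
    open IsCompletion xv
    above-x : ∀ i → 1 ≤ toℕ i → x ≤ lookup v i
    above-x (fsuc i) _ = ℕₚ.≮⇒≥ (avoids fzero (fsuc fzero) (fsuc (fsuc i)) z<s (s<s z<s))

  IsCompletion-∷⁺ : ∀ {m c p a x} {v : Vec ℕ m} → x ≤ c → p ≤ x →
                    IsCompletion (suc c) (p ⊔ a) x v → IsCompletion c p a (x ∷ v)
  IsCompletion-∷⁺ {c = c} {p} {a} {x} {v} x≤c p≤x v-ok = record
    { bounded = bounded′ ; above-p = above-p′ ; above-a = above-a′ ; avoids = avoids′ }
    where
    open IsCompletion v-ok
    bounded′ : ∀ i → lookup (x ∷ v) i ≤ c ℕ.+ toℕ i
    bounded′ fzero    = ≡.subst (x ≤_) (≡.sym (ℕₚ.+-identityʳ c)) x≤c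
    bounded′ (fsuc i) = ≡.subst (lookup v i ≤_) (≡.sym (ℕₚ.+-suc c (toℕ i))) (bounded i)
    above-p′ : ∀ i → p ≤ lookup (x ∷ v) i
    above-p′ fzero    = p≤x
    above-p′ (fsuc i) = ℕₚ.≤-trans (ℕₚ.m≤m⊔n p a) (above-p i)
    above-a′ : ∀ i → 1 ≤ toℕ i → a ≤ lookup (x ∷ v) i
    above-a′ (fsuc i) _ = ℕₚ.≤-trans (ℕₚ.m≤n⊔m p a) (above-p i)
    avoids′ : Avoids (x ∷ v)
    avoids′ fzero    (fsuc j) (fsuc k) _         (s<s j<k) = ℕₚ.≤⇒≯ (above-a k (ℕₚ.≤-trans (s≤s z≤n) j<k))
    avoids′ (fsuc i) (fsuc j) (fsuc k) (s<s i<j) (s<s j<k) = avoids i j k i<j j<k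

  IsCompletion⇒T : ∀ {m} c p a (v : Vec ℕ m) → IsCompletion c p a v → T (isCompletionᵇ c p a v)
  IsCompletion⇒T c p a []      _  = tt
  IsCompletion⇒T c p a (x ∷ v) xv with IsCompletion-∷⁻ xv
  ... | x≤c , p≤x , v-ok = Equivalence.from T-∧ (ℕₚ.≤⇒≤ᵇ x≤c ,
                           Equivalence.from T-∧ (ℕₚ.≤⇒≤ᵇ p≤x , IsCompletion⇒T (suc c) (p ⊔ a) x v v-ok))

  T⇒IsCompletion : ∀ {m} c p a (v : Vec ℕ m) → T (isCompletionᵇ c p a v) → IsCompletion c p a v
  T⇒IsCompletion c p a []      _ = record { bounded = λ () ; above-p = λ () ; above-a = λ () ; avoids = λ () }
  T⇒IsCompletion c p a (x ∷ v) t with Equivalence.to T-∧ t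
  ... | x≤ᵇc , rest with Equivalence.to T-∧ rest
  ... | p≤ᵇx , v-ok = IsCompletion-∷⁺ (ℕₚ.≤ᵇ⇒≤ x c x≤ᵇc) (ℕₚ.≤ᵇ⇒≤ p x p≤ᵇx)
                                     (T⇒IsCompletion (suc c) (p ⊔ a) x v v-ok)

  count : ∀ {A : Set} → (A → Bool) → List A → ℕ
  count f []       = 0
  count f (x ∷ xs) = (if f x then 1 else 0) ℕ.+ count f xs

  count-++ : ∀ {A : Set} (f : A → Bool) xs ys → count f (xs ++ ys) ≡ count f xs ℕ.+ count f ys
  count-++ f []       ys = ≡.refl
  count-++ f (x ∷ xs) ys = ≡.trans (≡.cong ((if f x then 1 else 0) ℕ.+_) (count-++ f xs ys))
                                   (≡.sym (ℕₚ.+-assoc (if f x then 1 else 0) _ _))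

  count-map : ∀ {A B : Set} (f : B → Bool) (g : A → B) xs → count f (map g xs) ≡ count (f ∘ g) xs
  count-map f g []       = ≡.refl
  count-map f g (x ∷ xs) = ≡.cong ((if f (g x) then 1 else 0) ℕ.+_) (count-map f g xs)

  count-∧ : ∀ {A : Set} b (f : A → Bool) xs → count (λ x → b ∧ f x) xs ≡ (if b then count f xs else 0)
  count-∧ true  f xs       = ≡.refl
  count-∧ false f []       = ≡.refl
  count-∧ false f (x ∷ xs) = count-∧ false f xs

  count-concatMap : ∀ {A B : Set} (f : B → Bool) (h : A → List B) (u : ℕ → A) N →
                    count f (concatMap h (applyUpTo u N)) ≡ ∑[ i < N ] count f (h (u i))
  count-concatMap f h u zero    = ≡.refl
  count-concatMap f h u (suc N) = begin
    count f (h (u 0) ++ concatMap h (applyUpTo (u ∘ suc) N))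
      ≡⟨ count-++ f (h (u 0)) _ ⟩
    count f (h (u 0)) ℕ.+ count f (concatMap h (applyUpTo (u ∘ suc) N))
      ≡⟨ ≡.cong (count f (h (u 0)) ℕ.+_) (count-concatMap f h (u ∘ suc) N) ⟩
    count f (h (u 0)) ℕ.+ ∑[ i < N ] count f (h (u (suc i)))
      ≡⟨ ∑-head N (λ i → count f (h (u i))) ⟨
    ∑[ i < suc N ] count f (h (u i)) ∎

  length-filter≡count : ∀ {A : Set} {P : A → Set} (P? : ∀ x → Dec (P x)) (f : A → Bool) →
    (∀ x → P x → T (f x)) → (∀ x → T (f x) → P x) → ∀ xs → length (filter P? xs) ≡ count f xs
  length-filter≡count P? f P⇒f f⇒P []       = ≡.refl
  length-filter≡count P? f P⇒f f⇒P (x ∷ xs) with P? x | f x in fx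
  ... | yes px | true  = ≡.cong suc (length-filter≡count P? f P⇒f f⇒P xs)
  ... | yes px | false = contradiction (≡.subst T fx (P⇒f x px)) id
  ... | no ¬px | true  = contradiction (f⇒P x (≡.subst T (≡.sym fx) tt)) ¬px
  ... | no ¬px | false = length-filter≡count P? f P⇒f f⇒P xs

  count-completions : ∀ N m c p a → c ℕ.+ m ≤ N →
                      count (isCompletionᵇ c p a) (allVecs N m) ≡ completions c p a m
  count-completions N zero    c p a _     = ≡.refl
  count-completions N (suc m) c p a c+m≤N = begin
    count (isCompletionᵇ c p a) (allVecs N (suc m))
      ≡⟨ count-concatMap (isCompletionᵇ c p a) (λ x → map (x ∷_) (allVecs N m)) id N ⟩
    ∑[ x < N ] count (isCompletionᵇ c p a) (map (x ∷_) (allVecs N m))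
      ≡⟨ ∑-cong N (λ x _ → first-entry x) ⟩
    ∑[ x < N ] (if x ≤ᵇ c then (if p ≤ᵇ x then completions (suc c) (p ⊔ a) x m else 0) else 0)
      ≡⟨ ∑-restrict-≤ N c _ (ℕₚ.≤-trans (s≤s (ℕₚ.m≤m+n c m)) 1+c+m≤N) ⟩
    completions c p a (suc m) ∎
    where
    1+c+m≤N : suc c ℕ.+ m ≤ N
    1+c+m≤N = ℕₚ.≤-trans (ℕₚ.≤-reflexive (≡.sym (ℕₚ.+-suc c m))) c+m≤N
    first-entry : ∀ x → count (isCompletionᵇ c p a) (map (x ∷_) (allVecs N m)) ≡
                        (if x ≤ᵇ c then (if p ≤ᵇ x then completions (suc c) (p ⊔ a) x m else 0) else 0)
    first-entry x = begin
      count (isCompletionᵇ c p a) (map (x ∷_) (allVecs N m))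
        ≡⟨ count-map (isCompletionᵇ c p a) (x ∷_) (allVecs N m) ⟩
      count (λ v → (x ≤ᵇ c) ∧ (p ≤ᵇ x) ∧ isCompletionᵇ (suc c) (p ⊔ a) x v) (allVecs N m)
        ≡⟨ count-∧ (x ≤ᵇ c) _ (allVecs N m) ⟩
      (if x ≤ᵇ c then count (λ v → (p ≤ᵇ x) ∧ isCompletionᵇ (suc c) (p ⊔ a) x v) (allVecs N m) else 0)
        ≡⟨ ≡.cong (λ n → if x ≤ᵇ c then n else 0) (count-∧ (p ≤ᵇ x) _ (allVecs N m)) ⟩
      (if x ≤ᵇ c then (if p ≤ᵇ x then count (isCompletionᵇ (suc c) (p ⊔ a) x) (allVecs N m) else 0) else 0)
        ≡⟨ ≡.cong (λ n → if x ≤ᵇ c then (if p ≤ᵇ x then n else 0) else 0)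
                  (count-completions N m (suc c) (p ⊔ a) x 1+c+m≤N) ⟩
      (if x ≤ᵇ c then (if p ≤ᵇ x then completions (suc c) (p ⊔ a) x m else 0) else 0) ∎

  I≡completions : ∀ n → I n ≡ completions 0 0 0 n
  I≡completions n = ≡.trans (length-filter≡count _ (isCompletionᵇ 0 0 0) to from (allVecs n n))
                            (count-completions n n 0 0 0 ℕₚ.≤-refl)
    where
    to : ∀ {m} (v : Vec ℕ m) → IsInversionSequence v × Avoids v → T (isCompletionᵇ 0 0 0 v)
    to v (inv , av) = IsCompletion⇒T 0 0 0 v record
      { bounded = λ i → ℕₚ.≤-pred (inv i) ; above-p = λ _ → z≤n ; above-a = λ _ _ → z≤n ; avoids = av }
    from : ∀ {m} (v : Vec ℕ m) → T (isCompletionᵇ 0 0 0 v) → IsInversionSequence v × Avoids v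
    from v t = (λ i → s≤s (bounded i)) , avoids
      where open IsCompletion (T⇒IsCompletion 0 0 0 v t)

module Recursion where

  open import Data.Nat using (_+_; _*_)
  open NatSum
  open Counting using (completions; I≡completions)
  open ≡.≡-Reasoning

  -- G g m counts completions of length m when the last entry is below p and
  -- the next entry has g + 2 admissible values (completions-below); F only has
  -- a meaning through its partial sums (∑-completions-above).
  mutual
    F : ℕ → ℕ → ℕ
    F g zero    = 1
    F g (suc m) = G g (suc m) + ∑[ i < g ] G (suc i) m

    G : ℕ → ℕ → ℕ
    G g zero    = 1
    G g (suc m) = ∑[ i < suc (suc g) ] F i m

  completions-step : ∀ m p k a →
    completions (p + k) p a (suc m) ≡ ∑[ t < suc k ] completions (suc (p + k)) (p ⊔ a) (p + t) m
  completions-step m p k a =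
    ≡.trans (≡.cong (λ n → ∑[ x < n ] (if p ≤ᵇ x then completions (suc (p + k)) (p ⊔ a) x m else 0))
                    (≡.sym (ℕₚ.+-suc p k)))
            (∑-restrict-≥ p (suc k) _)

  mutual
    completions-below : ∀ m p g a → a < p → completions (p + suc g) p a m ≡ G g m
    completions-below zero    p g a a<p = ≡.refl
    completions-below (suc m) p g a a<p = begin
      completions (p + suc g) p a (suc m)
        ≡⟨ completions-step m p (suc g) a ⟩
      ∑[ t < suc (suc g) ] completions (suc (p + suc g)) (p ⊔ a) (p + t) m
        ≡⟨ ≡.cong₂ (λ c q → ∑[ t < suc (suc g) ] completions c q (p + t) m)
                   (≡.sym (ℕₚ.+-suc p (suc g))) (ℕₚ.m≥n⇒m⊔n≡m (ℕₚ.<⇒≤ a<p)) ⟩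
      ∑[ t < suc (suc g) ] completions (p + suc (suc g)) p (p + t) m
        ≡⟨ ∑-completions-above m p (suc g) ⟩
      G g (suc m) ∎

    completions-above : ∀ m p j s →
      completions (p + suc (j + s)) p (p + j) (suc m) ≡ G s (suc m) + j * G (suc s) m
    completions-above m p j s = begin
      completions (p + suc (j + s)) p (p + j) (suc m)
        ≡⟨ completions-step m p (suc (j + s)) (p + j) ⟩
      ∑[ t < suc (suc (j + s)) ] completions c′ (p ⊔ (p + j)) (p + t) m
        ≡⟨ ≡.cong₂ (λ n q → ∑[ t < n ] completions c′ q (p + t) m)
                   range (ℕₚ.m≤n⇒m⊔n≡n (ℕₚ.m≤m+n p j)) ⟩
      ∑[ t < j + suc (suc s) ] completions c′ (p + j) (p + t) m
        ≡⟨ ∑-split j (suc (suc s)) _ ⟩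
      ∑[ t < j ] completions c′ (p + j) (p + t) m + ∑[ t < suc (suc s) ] completions c′ (p + j) (p + (j + t)) m
        ≡⟨ ≡.cong₂ _+_ (∑-const j (G (suc s) m) below)
                       (∑-cong (suc (suc s)) (λ t _ → ≡.cong₂ (λ c x → completions c (p + j) x m)
                                                               c′≡ (≡.sym (ℕₚ.+-assoc p j t)))) ⟩
      j * G (suc s) m + ∑[ t < suc (suc s) ] completions (p + j + suc (suc s)) (p + j) (p + j + t) m
        ≡⟨ ≡.cong (_+_ (j * G (suc s) m)) (∑-completions-above m (p + j) (suc s)) ⟩
      j * G (suc s) m + G s (suc m)
        ≡⟨ ℕₚ.+-comm (j * G (suc s) m) (G s (suc m)) ⟩
      G s (suc m) + j * G (suc s) m ∎
      where
      c′ : ℕ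
      c′ = suc (p + suc (j + s))
      range : suc (suc (j + s)) ≡ j + suc (suc s)
      range = ≡.sym (≡.trans (ℕₚ.+-suc j (suc s)) (≡.cong suc (ℕₚ.+-suc j s)))
      c′≡ : c′ ≡ p + j + suc (suc s)
      c′≡ = ≡.sym (≡.trans (ℕₚ.+-assoc p j (suc (suc s)))
                           (≡.trans (≡.cong (_+_ p) (≡.sym range)) (ℕₚ.+-suc p (suc (j + s)))))
      below : ∀ t → t < j → completions c′ (p + j) (p + t) m ≡ G (suc s) m
      below t t<j = ≡.trans (≡.cong (λ c → completions c (p + j) (p + t) m) c′≡)
                            (completions-below m (p + j) (suc s) (p + t) (ℕₚ.+-monoʳ-< p t<j))

    ∑-completions-above : ∀ m a N →
      ∑[ t < suc N ] completions (a + suc N) a (a + t) m ≡ ∑[ g < suc N ] F g m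
    ∑-completions-above zero    a N = ≡.refl
    ∑-completions-above (suc m) a N = begin
      ∑[ t < suc N ] completions (a + suc N) a (a + t) (suc m)
        ≡⟨ ∑-cong (suc N) (λ t t<1+N → ≡.trans (≡.cong (λ n → completions (a + suc n) a (a + t) (suc m))
                                                        (≡.sym (ℕₚ.m+[n∸m]≡n (ℕₚ.≤-pred t<1+N))))
                                                (completions-above m a t (N ∸ t))) ⟩
      ∑[ t < suc N ] (G (N ∸ t) (suc m) + t * G (suc (N ∸ t)) m)
        ≡⟨ ∑-distrib-+ (suc N) (λ t → G (N ∸ t) (suc m)) (λ t → t * G (suc (N ∸ t)) m) ⟩
      ∑[ t < suc N ] G (N ∸ t) (suc m) + ∑[ t < suc N ] (t * G (suc (N ∸ t)) m)
        ≡⟨ ≡.cong₂ _+_ (∑-reverse N (λ g → G g (suc m))) (∑-reverse-weighted N (λ g → G g m)) ⟩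
      ∑[ g < suc N ] G g (suc m) + ∑[ g < suc N ] ∑[ i < g ] G (suc i) m
        ≡⟨ ∑-distrib-+ (suc N) (λ g → G g (suc m)) (λ g → ∑[ i < g ] G (suc i) m) ⟨
      ∑[ g < suc N ] F g (suc m) ∎

  I-suc : ∀ n → I (suc n) ≡ F 0 n
  I-suc n = ≡.trans (I≡completions (suc n)) (∑-completions-above n 0 0)

W : PS
W n = + Recursion.F 0 n

-- The step relations say that the weights Qf g, Qb g at order m + 1 are the
-- transpose of the recursion for F and G applied to the weights at order m,
-- plus S at F 0.  So pairing the weights with F and G moves one step along the
-- recursion (pair-suc), and unfolding gives a convolution with S (pair-⊛).
module Pairing (Qf Qb : ℕ → PS) (S : PS)
  (Qf-step  : ∀ h → Qf (suc h) ⊖ Qf (suc (suc h)) ≗ z ⊛ (Qf h ⊕ Qb h))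
  (Qb-step  : ∀ h → Qb (suc h) ⊖ Qb (suc (suc h)) ≗ z ⊛ Qf (suc h))
  (Qf-base  : Qf 0 ⊖ Qf 1 ≗ S)
  (Qb-base  : Qb 0 ≗ 0ₚ)
  (Qf-order : ∀ g → HasOrder g (Qf g))
  (Qb-order : ∀ g → HasOrder g (Qb g))
  where

  open import Data.Integer using (ℤ; +_; _+_; _*_; _-_)
  open import Data.Integer.Tactic.RingSolver using (solve-∀)
  open IntSum
  open Recursion using (F; G)
  open ≡.≡-Reasoning

  Fℤ Gℤ : ℕ → ℕ → ℤ
  Fℤ g r = + F g r
  Gℤ g r = + G g r

  G-suc : ∀ h r → Gℤ h (suc r) ≡ ∑[ i < suc (suc h) ] Fℤ i r
  G-suc h r = pos-∑ (suc (suc h)) (λ i → F i r)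

  F-suc : ∀ h r → Fℤ h (suc r) ≡ Gℤ h (suc r) + ∑[ i < h ] Gℤ (suc i) r
  F-suc h r = ≡.trans (ℤₚ.pos-+ (G h (suc r)) _)
                      (≡.cong (_+_ (Gℤ h (suc r))) (pos-∑ h (λ i → G (suc i) r)))

  Qf-step-coeff : ∀ h m → Qf (suc h) (suc m) - Qf (suc (suc h)) (suc m) ≡ Qf h m + Qb h m
  Qf-step-coeff h m = ≡.trans (Qf-step h (suc m)) (z⊛-coeff-suc (Qf h ⊕ Qb h) m)

  Qb-step-coeff : ∀ h m → Qb (suc h) (suc m) - Qb (suc (suc h)) (suc m) ≡ Qf (suc h) m
  Qb-step-coeff h m = ≡.trans (Qb-step h (suc m)) (z⊛-coeff-suc (Qf (suc h)) m)

  pair : ℕ → ℕ → ℤ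
  pair m r = ∑[ g < suc m ] (Qf g m * Fℤ g r + Qb g m * Gℤ g r)

  pair-suc-F-part : ∀ m r → ∑[ g < suc (suc m) ] (Qf g (suc m) * Fℤ g r) ≡
               S (suc m) * Fℤ 0 r + ∑[ h < suc m ] ((Qf h m + Qb h m) * Gℤ h (suc r))
  pair-suc-F-part m r = begin
    ∑[ g < suc (suc m) ] (p g * Fℤ g r)
      ≡⟨ ∑-by-parts (suc m) p (λ g → Fℤ g r) ⟩
    ∑[ g < suc (suc m) ] ((p g - p (suc g)) * ΣF g) + p (suc (suc m)) * ΣF (suc m)
      ≡⟨ ≡.cong (λ x → ∑[ g < suc (suc m) ] ((p g - p (suc g)) * ΣF g) + x * ΣF (suc m))
                (Qf-order (suc (suc m)) (suc m) (ℕₚ.n<1+n (suc m))) ⟩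
    ∑[ g < suc (suc m) ] ((p g - p (suc g)) * ΣF g) + + 0 * ΣF (suc m)
      ≡⟨ ℤₚ.+-identityʳ _ ⟩
    ∑[ g < suc (suc m) ] ((p g - p (suc g)) * ΣF g)
      ≡⟨ ∑-head (suc m) (λ g → (p g - p (suc g)) * ΣF g) ⟩
    (p 0 - p 1) * ΣF 0 + ∑[ h < suc m ] ((p (suc h) - p (suc (suc h))) * ΣF (suc h))
      ≡⟨ ≡.cong₂ _+_ (≡.cong₂ _*_ (Qf-base (suc m)) (ℤₚ.+-identityˡ (Fℤ 0 r)))
                     (∑-cong (suc m) (λ h _ → ≡.cong₂ _*_ (Qf-step-coeff h m) (≡.sym (G-suc h r)))) ⟩
    S (suc m) * Fℤ 0 r + ∑[ h < suc m ] ((Qf h m + Qb h m) * Gℤ h (suc r)) ∎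
    where
    p : ℕ → ℤ
    p g = Qf g (suc m)
    ΣF : ℕ → ℤ
    ΣF g = ∑[ i < suc g ] Fℤ i r

  pair-suc-G-part : ∀ m r → ∑[ g < suc (suc m) ] (Qb g (suc m) * Gℤ g r) ≡
               ∑[ h < suc m ] (Qf h m * ∑[ i < h ] Gℤ (suc i) r)
  pair-suc-G-part m r = begin
    ∑[ g < suc (suc m) ] (p g * Gℤ g r)
      ≡⟨ ∑-head (suc m) (λ g → p g * Gℤ g r) ⟩
    p 0 * Gℤ 0 r + ∑[ h < suc m ] (p (suc h) * Gℤ (suc h) r)
      ≡⟨ ≡.cong₂ _+_ (≡.cong (_* Gℤ 0 r) (Qb-base (suc m)))
                     (∑-by-parts m (p ∘ suc) (λ h → Gℤ (suc h) r)) ⟩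
    + 0 + (∑[ h < suc m ] ((p (suc h) - p (suc (suc h))) * ΣG h) + p (suc (suc m)) * ΣG m)
      ≡⟨ ≡.cong (λ x → + 0 + (∑[ h < suc m ] ((p (suc h) - p (suc (suc h))) * ΣG h) + x * ΣG m))
                (Qb-order (suc (suc m)) (suc m) (ℕₚ.n<1+n (suc m))) ⟩
    + 0 + (∑[ h < suc m ] ((p (suc h) - p (suc (suc h))) * ΣG h) + + 0 * ΣG m)
      ≡⟨ ≡.trans (ℤₚ.+-identityˡ _) (ℤₚ.+-identityʳ _) ⟩
    ∑[ h < suc m ] ((p (suc h) - p (suc (suc h))) * ΣG h)
      ≡⟨ ∑-cong (suc m) (λ h _ → ≡.cong (_* ΣG h) (Qb-step-coeff h m)) ⟩
    ∑[ h < m ] (Qf (suc h) m * ΣG h) + Qf (suc m) m * ΣG m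
      ≡⟨ ≡.cong (λ x → ∑[ h < m ] (Qf (suc h) m * ΣG h) + x * ΣG m) (Qf-order (suc m) m (ℕₚ.n<1+n m)) ⟩
    ∑[ h < m ] (Qf (suc h) m * ΣG h) + + 0 * ΣG m
      ≡⟨ ℤₚ.+-identityʳ _ ⟩
    ∑[ h < m ] (Qf (suc h) m * ΣG h)
      ≡⟨ ≡.trans (≡.cong (_+ ∑[ h < m ] (Qf (suc h) m * ΣG h)) (ℤₚ.*-zeroʳ (Qf 0 m)))
                 (ℤₚ.+-identityˡ _) ⟨
    Qf 0 m * + 0 + ∑[ h < m ] (Qf (suc h) m * ΣG h)
      ≡⟨ ∑-head m (λ h → Qf h m * ∑[ i < h ] Gℤ (suc i) r) ⟨
    ∑[ h < suc m ] (Qf h m * ∑[ i < h ] Gℤ (suc i) r) ∎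
    where
    p : ℕ → ℤ
    p g = Qb g (suc m)
    ΣG : ℕ → ℤ
    ΣG h = ∑[ i < suc h ] Gℤ (suc i) r

  pair-suc : ∀ m r → pair (suc m) r ≡ S (suc m) * Fℤ 0 r + pair m (suc r)
  pair-suc m r = begin
    pair (suc m) r
      ≡⟨ ∑-distrib-+ (suc (suc m)) (λ g → Qf g (suc m) * Fℤ g r) (λ g → Qb g (suc m) * Gℤ g r) ⟩
    ∑[ g < suc (suc m) ] (Qf g (suc m) * Fℤ g r) + ∑[ g < suc (suc m) ] (Qb g (suc m) * Gℤ g r)
      ≡⟨ ≡.cong₂ _+_ (pair-suc-F-part m r) (pair-suc-G-part m r) ⟩
    S (suc m) * Fℤ 0 r + ∑[ h < suc m ] A h + ∑[ h < suc m ] B h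
      ≡⟨ ℤₚ.+-assoc (S (suc m) * Fℤ 0 r) _ _ ⟩
    S (suc m) * Fℤ 0 r + (∑[ h < suc m ] A h + ∑[ h < suc m ] B h)
      ≡⟨ ≡.cong (_+_ (S (suc m) * Fℤ 0 r)) (∑-distrib-+ (suc m) A B) ⟨
    S (suc m) * Fℤ 0 r + ∑[ h < suc m ] (A h + B h)
      ≡⟨ ≡.cong (_+_ (S (suc m) * Fℤ 0 r)) (∑-cong (suc m) (λ h _ → collect h)) ⟩
    S (suc m) * Fℤ 0 r + pair m (suc r) ∎
    where
    A B : ℕ → ℤ
    A h = (Qf h m + Qb h m) * Gℤ h (suc r)
    B h = Qf h m * ∑[ i < h ] Gℤ (suc i) r
    regroup : ∀ a b x y → (a + b) * x + a * y ≡ a * (x + y) + b * x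
    regroup = solve-∀
    collect : ∀ h → A h + B h ≡ Qf h m * Fℤ h (suc r) + Qb h m * Gℤ h (suc r)
    collect h = ≡.trans (regroup (Qf h m) (Qb h m) (Gℤ h (suc r)) _)
                        (≡.cong (λ x → Qf h m * x + Qb h m * Gℤ h (suc r)) (≡.sym (F-suc h r)))

  pair-0 : ∀ r → pair 0 r ≡ S 0 * Fℤ 0 r
  pair-0 r = begin
    + 0 + (Qf 0 0 * Fℤ 0 r + Qb 0 0 * Gℤ 0 r)   ≡⟨ ℤₚ.+-identityˡ _ ⟩
    Qf 0 0 * Fℤ 0 r + Qb 0 0 * Gℤ 0 r           ≡⟨ ≡.cong₂ _+_ (≡.cong (_* Fℤ 0 r) Qf00≡S0)
                                                               (≡.cong (_* Gℤ 0 r) (Qb-base 0)) ⟩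
    S 0 * Fℤ 0 r + + 0 * Gℤ 0 r                 ≡⟨ ℤₚ.+-identityʳ _ ⟩
    S 0 * Fℤ 0 r                                ∎
    where
    Qf00≡S0 : Qf 0 0 ≡ S 0
    Qf00≡S0 = begin
      Qf 0 0             ≡⟨ ℤₚ.+-identityʳ (Qf 0 0) ⟨
      Qf 0 0 + + 0       ≡⟨ ≡.cong (λ x → Qf 0 0 - x) (Qf-order 1 0 (ℕₚ.n<1+n 0)) ⟨
      Qf 0 0 - Qf 1 0    ≡⟨ Qf-base 0 ⟩
      S 0                ∎

  Wᵣ : ℕ → PS
  Wᵣ r n = Fℤ 0 (n ℕ.+ r)

  pair-⊛ : ∀ m r → pair m r ≡ (S ⊛ Wᵣ r) m
  pair-⊛ zero    r = ≡.trans (pair-0 r) (≡.sym (⊛-coeff-0 S (Wᵣ r)))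
  pair-⊛ (suc m) r = begin
    pair (suc m) r
      ≡⟨ pair-suc m r ⟩
    S (suc m) * Fℤ 0 r + pair m (suc r)
      ≡⟨ ≡.cong (_+_ (S (suc m) * Fℤ 0 r)) (pair-⊛ m (suc r)) ⟩
    S (suc m) * Fℤ 0 r + (S ⊛ Wᵣ (suc r)) m
      ≡⟨ ℤₚ.+-comm (S (suc m) * Fℤ 0 r) _ ⟩
    (S ⊛ Wᵣ (suc r)) m + S (suc m) * Fℤ 0 r
      ≡⟨ ≡.cong (_+ S (suc m) * Fℤ 0 r) (⊛-cong {S} (λ _ → ≡.refl) shift-Wᵣ m) ⟩
    (S ⊛ shift (Wᵣ r)) m + S (suc m) * Wᵣ r 0
      ≡⟨ ⊛-coeff-sucʳ S (Wᵣ r) m ⟨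
    (S ⊛ Wᵣ r) (suc m) ∎
    where
    shift-Wᵣ : Wᵣ (suc r) ≗ shift (Wᵣ r)
    shift-Wᵣ n = ≡.cong (Fℤ 0) (ℕₚ.+-suc n r)

  pairing : S ⊛ W ≗ ∑ₚ (λ g → Qf g ⊕ Qb g)
  pairing m = ≡.trans (⊛-cong {S} (λ _ → ≡.refl) (λ n → ≡.cong (Fℤ 0) (≡.sym (ℕₚ.+-identityʳ n))) m)
            (≡.trans (≡.sym (pair-⊛ m 0))
                      (∑-cong (suc m) (λ g _ → ≡.cong₂ _+_ (ℤₚ.*-identityʳ (Qf g m))
                                                           (ℤₚ.*-identityʳ (Qb g m)))))

Φ : PS → PS
Φ X = one ⊖ X ⊕ z ⊖ z ⊛ X ⊕ two ⊛ z ⊛ X ⊛ X ⊖ z ⊛ z ⊛ X ⊛ X ⊛ X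

module KernelWeights (X : PS) (Φ≗0 : Φ X ≗ 0ₚ) where

  open import Algebra.Properties.Semiring.Exp (CommutativeRing.semiring commutativeRing) using (_^_)
  open import Data.Integer using (+_; _+_; _-_; _*_)
  open Solver
  open IntSum using (∑<; ∑-head; ∑-cong; ∑-telescope)

  u ω D S : PS
  u = z ⊛ X
  ω = one ⊖ u
  D = ω ⊖ z
  S = ω ⊛ D

  -- Qb-step and Qf-base hold identically, whereas Qf-step for h ≥ 1 holds only
  -- modulo Φ X.
  Qf Qb : ℕ → PS
  Qf zero    = ω ⊛ ω
  Qf (suc g) = z ⊛ ω ⊛ u ^ g
  Qb zero    = 0ₚ
  Qb (suc g) = z ⊛ z ⊛ u ^ g

  ω̂ : ∀ {n} → Polynomial n → Polynomial n → Polynomial n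
  ω̂ ẑ x̂ = con (+ 1) :- ẑ :* x̂

  Φ̂ : ∀ {n} → Polynomial n → Polynomial n → Polynomial n
  Φ̂ ẑ x̂ = con (+ 1) :- x̂ :+ ẑ :- ẑ :* x̂ :+ con (+ 2) :* ẑ :* x̂ :* x̂ :- ẑ :* ẑ :* x̂ :* x̂ :* x̂

  Qf-step : ∀ h → Qf (suc h) ⊖ Qf (suc (suc h)) ≗ z ⊛ (Qf h ⊕ Qb h)
  Qf-step zero = begin
    Qf 1 ⊖ Qf 2
      ≈⟨ solve 2 (λ ẑ x̂ → ẑ :* ω̂ ẑ x̂ :* con (+ 1) :- ẑ :* ω̂ ẑ x̂ :* (ẑ :* x̂ :* con (+ 1))
                        := ẑ :* (ω̂ ẑ x̂ :* ω̂ ẑ x̂))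
                 (λ _ → ≡.refl) z X ⟩
    z ⊛ Qf 0
      ≈⟨ ⊛-cong {z} (λ _ → ≡.refl) (λ n → ≡.sym (ℤₚ.+-identityʳ (Qf 0 n))) ⟩
    z ⊛ (Qf 0 ⊕ Qb 0) ∎
    where open ≗-Reasoning
  Qf-step (suc k) = begin
    Qf (suc (suc k)) ⊖ Qf (suc (suc (suc k)))
      ≈⟨ solve 3 (λ ẑ x̂ l̂ →
                    ẑ :* ω̂ ẑ x̂ :* (ẑ :* x̂ :* l̂) :- ẑ :* ω̂ ẑ x̂ :* (ẑ :* x̂ :* (ẑ :* x̂ :* l̂))
                    := ẑ :* (ẑ :* ω̂ ẑ x̂ :* l̂ :+ ẑ :* ẑ :* l̂) :+ (:- (ẑ :* ẑ :* l̂)) :* Φ̂ ẑ x̂)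
                 (λ _ → ≡.refl) z X (u ^ k) ⟩
    z ⊛ (Qf (suc k) ⊕ Qb (suc k)) ⊕ (-ₚ (z ⊛ z ⊛ u ^ k)) ⊛ Φ X
      ≈⟨ ⊕-⊛-zeroʳ (z ⊛ (Qf (suc k) ⊕ Qb (suc k))) (-ₚ (z ⊛ z ⊛ u ^ k)) Φ≗0 ⟩
    z ⊛ (Qf (suc k) ⊕ Qb (suc k)) ∎
    where open ≗-Reasoning

  Qb-step : ∀ h → Qb (suc h) ⊖ Qb (suc (suc h)) ≗ z ⊛ Qf (suc h)
  Qb-step h = solve 3 (λ ẑ x̂ l̂ → ẑ :* ẑ :* l̂ :- ẑ :* ẑ :* (ẑ :* x̂ :* l̂)
                                 := ẑ :* (ẑ :* ω̂ ẑ x̂ :* l̂))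
                      (λ _ → ≡.refl) z X (u ^ h)

  Qf-base : Qf 0 ⊖ Qf 1 ≗ S
  Qf-base = solve 2 (λ ẑ x̂ → ω̂ ẑ x̂ :* ω̂ ẑ x̂ :- ẑ :* ω̂ ẑ x̂ :* con (+ 1)
                            := ω̂ ẑ x̂ :* (ω̂ ẑ x̂ :- ẑ))
                    (λ _ → ≡.refl) z X

  u^-hasOrder : ∀ g → HasOrder g (u ^ g)
  u^-hasOrder zero    = λ _ ()
  u^-hasOrder (suc g) = ⊛-hasOrder 1 g (z⊛-hasOrder X) (u^-hasOrder g)

  Qf-order : ∀ g → HasOrder g (Qf g)
  Qf-order zero    = λ _ ()
  Qf-order (suc g) = ⊛-hasOrder 1 g (z⊛-hasOrder ω) (u^-hasOrder g)

  Qb-order : ∀ g → HasOrder g (Qb g)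
  Qb-order zero    = λ _ ()
  Qb-order (suc g) = ⊛-hasOrder 1 g (z⊛-hasOrder z) (u^-hasOrder g)

  open Pairing Qf Qb S Qf-step Qb-step Qf-base (λ _ → ≡.refl) Qf-order Qb-order using (pairing)

  Q : ℕ → PS
  Q g = Qf g ⊕ Qb g

  Q-order : ∀ g → HasOrder g (Q g)
  Q-order g n n<g = ≡.cong₂ _+_ (Qf-order g n n<g) (Qb-order g n n<g)

  ω-telescope : ∀ g → ω ⊛ Q (suc g) ≗ Q (suc g) ⊖ Q (suc (suc g))
  ω-telescope g = solve 3 (λ ẑ x̂ l̂ →
                              ω̂ ẑ x̂ :* (ẑ :* ω̂ ẑ x̂ :* l̂ :+ ẑ :* ẑ :* l̂)
                              := ẑ :* ω̂ ẑ x̂ :* l̂ :+ ẑ :* ẑ :* l̂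
                                 :- (ẑ :* ω̂ ẑ x̂ :* (ẑ :* x̂ :* l̂) :+ ẑ :* ẑ :* (ẑ :* x̂ :* l̂)))
                          (λ _ → ≡.refl) z X (u ^ g)

  ω⊛∑Q : ω ⊛ ∑ₚ Q ≗ ω ⊛ Qf 0 ⊕ Q 1
  ω⊛∑Q m = begin
    (ω ⊛ ∑ₚ Q) m
      ≡⟨ ⊛-∑ₚ Q Q-order ω m ⟩
    ∑[ g < suc m ] (ω ⊛ Q g) m
      ≡⟨ ∑-head m (λ g → (ω ⊛ Q g) m) ⟩
    (ω ⊛ Q 0) m + ∑[ g < m ] (ω ⊛ Q (suc g)) m
      ≡⟨ ≡.cong₂ _+_ (⊛-cong {ω} (λ _ → ≡.refl) (λ n → ℤₚ.+-identityʳ (Qf 0 n)) m)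
                     (∑-cong m (λ g _ → ω-telescope g m)) ⟩
    (ω ⊛ Qf 0) m + ∑[ g < m ] (Q (suc g) m - Q (suc (suc g)) m)
      ≡⟨ ≡.cong (_+_ ((ω ⊛ Qf 0) m)) (∑-telescope m (λ g → Q (suc g) m)) ⟩
    (ω ⊛ Qf 0) m + (Q 1 m - Q (suc m) m)
      ≡⟨ ≡.cong (λ x → (ω ⊛ Qf 0) m + (Q 1 m - x)) (Q-order (suc m) m (ℕₚ.n<1+n m)) ⟩
    (ω ⊛ Qf 0) m + (Q 1 m + + 0)
      ≡⟨ ≡.cong (_+_ ((ω ⊛ Qf 0) m)) (ℤₚ.+-identityʳ (Q 1 m)) ⟩
    (ω ⊛ Qf 0) m + Q 1 m ∎
    where open ≡.≡-Reasoning

  W⊛D⊖one≗0 : W ⊛ D ⊖ one ≗ 0ₚ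
  W⊛D⊖one≗0 = ⊛-cancel-unit {g = ω ⊛ ω} ω⊛ω-coeff-0 [W⊛D⊖one]⊛ω⊛ω≗0
    where
    ω⊛ω-coeff-0 : (ω ⊛ ω) 0 ≡ + 1
    ω⊛ω-coeff-0 = ≡.trans (⊛-coeff-0 ω ω) (≡.cong (λ x → (+ 1 - x) * (+ 1 - x)) (z⊛-coeff-0 X))
    [W⊛D⊖one]⊛ω⊛ω≗0 : (W ⊛ D ⊖ one) ⊛ (ω ⊛ ω) ≗ 0ₚ
    [W⊛D⊖one]⊛ω⊛ω≗0 = begin
      (W ⊛ D ⊖ one) ⊛ (ω ⊛ ω)
        ≈⟨ solve 3 (λ ẑ x̂ ŵ → (ŵ :* (ω̂ ẑ x̂ :- ẑ) :- con (+ 1)) :* (ω̂ ẑ x̂ :* ω̂ ẑ x̂)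
                            := ω̂ ẑ x̂ :* (ω̂ ẑ x̂ :* (ω̂ ẑ x̂ :- ẑ) :* ŵ) :- ω̂ ẑ x̂ :* ω̂ ẑ x̂)
                   (λ _ → ≡.refl) z X W ⟩
      ω ⊛ (S ⊛ W) ⊖ ω ⊛ ω
        ≈⟨ (λ n → ≡.cong (_- (ω ⊛ ω) n)
                         (≡.trans (⊛-cong {ω} (λ _ → ≡.refl) pairing n) (ω⊛∑Q n))) ⟩
      ω ⊛ Qf 0 ⊕ Q 1 ⊖ ω ⊛ ω
        ≈⟨ solve 2 (λ ẑ x̂ →
                      ω̂ ẑ x̂ :* (ω̂ ẑ x̂ :* ω̂ ẑ x̂) :+ (ẑ :* ω̂ ẑ x̂ :* con (+ 1) :+ ẑ :* ẑ :* con (+ 1))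
                        :- ω̂ ẑ x̂ :* ω̂ ẑ x̂
                      := ẑ :* Φ̂ ẑ x̂)
                   (λ _ → ≡.refl) z X ⟩
      z ⊛ Φ X
        ≈⟨ ⊛-zeroʳ z Φ≗0 ⟩
      0ₚ ∎
      where open ≗-Reasoning

GF≗one⊕z⊛W : GF ≗ one ⊕ z ⊛ W
GF≗one⊕z⊛W zero    = ≡.cong (ℤ._+_ (+ 1)) (≡.sym (z⊛-coeff-0 W))
GF≗one⊕z⊛W (suc n) = ≡.trans (≡.cong +_ (Recursion.I-suc n))
                              (≡.sym (≡.trans (ℤₚ.+-identityˡ _) (z⊛-coeff-suc W n)))

mainTheorem5 : (X : PS) →
    (∀ n → (one ⊖ X ⊕ z ⊖ z ⊛ X ⊕ two ⊛ z ⊛ X ⊛ X ⊖ z ⊛ z ⊛ X ⊛ X ⊛ X) n ≡ + 0) →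
    ∀ n → (GF ⊛ (z ⊛ (one ⊕ z) ⊛ X)) n
          ≡ ((one ⊕ z) ⊛ (X ⊖ one) ⊖ z ⊛ (one ⊖ z) ⊛ X ⊛ X) n
mainTheorem5 X Φ≗0 n =
  ℤₚ.i-j≡0⇒i≡j (lhs n) (rhs n) (⊛-cancel-unit {lhs ⊖ rhs} {D} D-coeff-0 Δ⊛D≗0 n)
  where
  open KernelWeights X Φ≗0 using (ω̂; Φ̂; D; W⊛D⊖one≗0)
  open CommutativeRing commutativeRing using (+-congʳ; *-congʳ)
  open Solver
  open ≗-Reasoning
  lhs rhs : PS
  lhs = GF ⊛ (z ⊛ (one ⊕ z) ⊛ X)
  rhs = (one ⊕ z) ⊛ (X ⊖ one) ⊖ z ⊛ (one ⊖ z) ⊛ X ⊛ X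
  D-coeff-0 : D 0 ≡ + 1
  D-coeff-0 = ≡.cong (λ x → + 1 ℤ.- x ℤ.- + 0) (z⊛-coeff-0 X)
  Δ⊛D≗0 : (lhs ⊖ rhs) ⊛ D ≗ 0ₚ
  Δ⊛D≗0 = begin
    (lhs ⊖ rhs) ⊛ D
      ≈⟨ *-congʳ {D} (+-congʳ { -ₚ rhs} (*-congʳ {z ⊛ (one ⊕ z) ⊛ X} GF≗one⊕z⊛W)) ⟩
    ((one ⊕ z ⊛ W) ⊛ (z ⊛ (one ⊕ z) ⊛ X) ⊖ rhs) ⊛ D
      ≈⟨ solve 3 (λ ẑ x̂ ŵ →
           ((con (+ 1) :+ ẑ :* ŵ) :* (ẑ :* (con (+ 1) :+ ẑ) :* x̂)
             :- ((con (+ 1) :+ ẑ) :* (x̂ :- con (+ 1)) :- ẑ :* (con (+ 1) :- ẑ) :* x̂ :* x̂)) :* (ω̂ ẑ x̂ :- ẑ)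
           := (con (+ 1) :- ẑ) :* Φ̂ ẑ x̂ :+ ẑ :* ẑ :* (con (+ 1) :+ ẑ) :* x̂ :* (ŵ :* (ω̂ ẑ x̂ :- ẑ) :- con (+ 1)))
           (λ _ → ≡.refl) z X W ⟩
    (one ⊖ z) ⊛ Φ X ⊕ z ⊛ z ⊛ (one ⊕ z) ⊛ X ⊛ (W ⊛ D ⊖ one)
      ≈⟨ (λ m → ≡.cong₂ ℤ._+_ (⊛-zeroʳ (one ⊖ z) Φ≗0 m)
                              (⊛-zeroʳ (z ⊛ z ⊛ (one ⊕ z) ⊛ X) W⊛D⊖one≗0 m)) ⟩
    0ₚ ∎
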